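{- Let $\mathbf{k}$ be a commutative unitary ring. The set $\{M_\alpha \mid \alpha\in \mathbb{N}^{k-1}\times \mathbb{P},\ k\geq 1\}$ (i.e. $M_\alpha$ for $\alpha$ ranging over all left weak compositions) is a $\mathbf{k}$-basis of the $\mathbf{k}$-module $\mathrm{LWCQSym}$ of LWC quasi-symmetric functions.
   Context: $\mathbb{N}$ and $\mathbb{P}$ denote the nonnegative and positive integers. Let $x_1,x_2,\ldots$ be countably many commuting variables. A left weak composition is a finite nonempty sequence $\alpha=(\alpha_1,\ldots,\alpha_k)$ of nonnegative integers with $\alpha_k>0$. Its LWC monomial quasi-symmetric function is $M_\alpha=\sum_{1\leq n_1<\cdots<n_k}x_{n_1}^{\alpha_1}\cdots x_{n_k}^{\alpha_k}\in\mathbf{k}[[x_1,x_2,\ldots]]$ (with $x^0=1$). $\mathrm{LWCQSym}$ is the set of formal power series of finite degree which are (finite) $\mathbf{k}$-linear combinations of the $M_\alpha$, $\alpha$ a left weak composition. -}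

module Defs where

open import Level using (Level; _⊔_)
open import Data.Nat using (ℕ; zero; suc; _≡ᵇ_)
open import Data.Bool using (Bool; true; false; if_then_else_)
open import Data.List using (List; []; _∷_; _++_; [_]; map)
open import Data.List.Relation.Unary.All using (All)
open import Data.List.Relation.Unary.Unique.Propositional using (Unique)
open import Data.Product using (Σ; _×_; _,_; proj₁; proj₂; ∃)
open import Algebra.Bundles using (CommutativeRing)

-- A left weak composition (α₁,…,α_{k-1}, α_k) ∈ ℕ^{k-1} × ℙ, k ≥ 1,
-- encoded as the pair (β , p) meaning α = β ++ [ suc p ]  (so α_k = p+1 > 0).
LWC : Set
LWC = List ℕ × ℕ

toList : LWC → List ℕ
toList (β , p) = β ++ [ suc p ]

-- A monomial x₁^{e₁} x₂^{e₂} ⋯ x_m^{e_m} is given by its exponent list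
-- (e₁, …, e_m); all variables beyond position m have exponent 0.
Monomial : Set
Monomial = List ℕ

allZero : List ℕ → Bool
allZero []            = true
allZero (zero ∷ e)    = allZero e
allZero (suc _ ∷ e)   = false

-- ways α e = number of tuples 1 ≤ n₁ < ⋯ < n_k with
-- x_{n₁}^{α₁} ⋯ x_{n_k}^{α_k} = x^e, i.e. the coefficient of x^e in M_α.
-- Recursion on the first variable x₁:
--   M_α(x₁,x₂,…) = x₁^{α₁} M_{(α₂,…,α_k)}(x₂,…) + M_α(x₂,x₃,…).
-- The clause  ways (a ∷ α) [] = 0  is correct for left weak compositions
-- (the last part is positive, so it cannot sit on a variable of exponent 0).
ways : List ℕ → Monomial → ℕ
ways []      e       = if allZero e then 1 else 0
ways (a ∷ α) []      = 0
ways (a ∷ α) (x ∷ e) =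
  (if a ≡ᵇ x then ways α e else 0) Data.Nat.+ (if x ≡ᵇ 0 then ways (a ∷ α) e else 0)

module _ {c ℓ : Level} (R : CommutativeRing c ℓ) where
  open CommutativeRing R

  fromℕ : ℕ → Carrier
  fromℕ zero    = 0#
  fromℕ (suc n) = 1# + fromℕ n

  Series : Set c
  Series = Monomial → Carrier

  M : LWC → Series
  M α e = fromℕ (ways (toList α) e)

  lincomb : List (Carrier × LWC) → Series
  lincomb []             e = 0#
  lincomb ((a , α) ∷ xs) e = a * M α e + lincomb xs e

  InLWCQSym : Series → Set (c ⊔ ℓ)
  InLWCQSym f = ∃ λ (xs : List (Carrier × LWC)) → ∀ e → f e ≈ lincomb xs e

  Spans : Set (c ⊔ ℓ)
  Spans = (∀ α → InLWCQSym (M α))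
        × (∀ f → InLWCQSym f → ∃ λ (xs : List (Carrier × LWC)) → ∀ e → f e ≈ lincomb xs e)

  LinIndep : Set (c ⊔ ℓ)
  LinIndep = ∀ (xs : List (Carrier × LWC)) → Unique (map proj₂ xs)
           → (∀ e → lincomb xs e ≈ 0#) → All (λ p → proj₁ p ≈ 0#) xs

  IsBasisOfLWCQSym : Set (c ⊔ ℓ)
  IsBasisOfLWCQSym = Spans × LinIndep

-- The coefficient of x^{toList β} in M_α is 1 for α = β, and 0 for α ≠ β
-- unless α is strictly shorter than β.  So if Σ c_α M_α = 0 with distinct α and all c_α
-- with |α| < n already vanish, the coefficient of x^{toList α} for |α| = n
-- is exactly c_α, hence c_α = 0; induction on n gives linear independence.
module Submission where

open import Defs
open import Algebra.Bundles using (CommutativeRing)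
open import Level using (Level; _⊔_)
open import Data.Nat using (ℕ; suc; _≡ᵇ_; _≤_; _<_; s≤s; _≟_)
open import Data.Nat.Properties as ℕ
  using (≤-refl; ≤-reflexive; ≮⇒≥; m<n⇒m<1+n; m≤n⇒m<n∨m≡n; m<1+n⇒m<n∨m≡n; ≡ᵇ⇒≡; ≡⇒≡ᵇ; suc-injective)
open import Data.Bool using (true; false)
open import Data.Bool.Properties using (if-eta)
open import Data.List using (List; []; _∷_; map; length)
open import Data.List.Properties using (∷ʳ-injective)
open import Data.List.Relation.Unary.All as All using (All)
open import Data.List.Relation.Unary.All.Properties using (All¬⇒¬Any)
open import Data.List.Relation.Unary.Any using (here; there)
open import Data.List.Relation.Unary.AllPairs using (_∷_)
open import Data.List.Relation.Unary.Unique.Propositional using (Unique)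
open import Data.List.Membership.Propositional using (_∈_; _∉_)
open import Data.List.Membership.Propositional.Properties using (∈-map⁺)
open import Data.Product using (_×_; _,_; proj₂)
open import Data.Sum using (_⊎_; inj₁; inj₂)
open import Data.Empty using (⊥-elim)
open import Function using (_∘_)
open import Relation.Binary.PropositionalEquality using (_≡_; _≢_; refl; sym; trans; cong)
open import Relation.Nullary using (yes; no)

length<⇒ways≡0 : ∀ α e → length e < length α → ways α e ≡ 0
length<⇒ways≡0 (a ∷ α) []      _        = refl
length<⇒ways≡0 (a ∷ α) (x ∷ e) (s≤s lt)
  rewrite length<⇒ways≡0 α e lt | length<⇒ways≡0 (a ∷ α) e (m<n⇒m<1+n lt)
        | if-eta (a ≡ᵇ x) {0} | if-eta (x ≡ᵇ 0) {0} = refl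

ways≢0⇒length≤ : ∀ α e → ways α e ≢ 0 → length α ≤ length e
ways≢0⇒length≤ α e ways≢0 = ≮⇒≥ (ways≢0 ∘ length<⇒ways≡0 α e)

ways≢0∧length≡⇒≡ : ∀ α e → length α ≡ length e → ways α e ≢ 0 → α ≡ e
ways≢0∧length≡⇒≡ []      []      _  _ = refl
ways≢0∧length≡⇒≡ (a ∷ α) (x ∷ e) eq ways≢0
  rewrite length<⇒ways≡0 (a ∷ α) e (≤-reflexive (sym eq)) | if-eta (x ≡ᵇ 0) {0}
  with a ≡ᵇ x | ≡ᵇ⇒≡ a x
... | false | _   = ⊥-elim (ways≢0 refl)
... | true  | a≡x with refl ← a≡x _ =
  cong (a ∷_) (ways≢0∧length≡⇒≡ α e (suc-injective eq) (ways≢0 ∘ trans (ℕ.+-identityʳ _)))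

ways-triangular : ∀ α e → ways α e ≢ 0 → α ≡ e ⊎ length α < length e
ways-triangular α e ways≢0 with m≤n⇒m<n∨m≡n (ways≢0⇒length≤ α e ways≢0)
... | inj₁ lt = inj₂ lt
... | inj₂ eq = inj₁ (ways≢0∧length≡⇒≡ α e eq ways≢0)

ways-diagonal : ∀ e → ways e e ≡ 1
ways-diagonal []      = refl
ways-diagonal (a ∷ e)
  rewrite length<⇒ways≡0 (a ∷ e) e ≤-refl | if-eta (a ≡ᵇ 0) {0}
  with a ≡ᵇ a | ≡⇒≡ᵇ a a refl
... | true | _ rewrite ways-diagonal e = refl

toList-injective : ∀ α β → toList α ≡ toList β → α ≡ β
toList-injective (α , p) (β , q) eq with refl , refl ← ∷ʳ-injective α β eq = refl

len : LWC → ℕ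
len = length ∘ toList

ways-toList-triangular : ∀ β α → ways (toList β) (toList α) ≢ 0 → β ≡ α ⊎ len β < len α
ways-toList-triangular β α ways≢0 with ways-triangular (toList β) (toList α) ways≢0
... | inj₁ eq = inj₁ (toList-injective β α eq)
... | inj₂ lt = inj₂ lt


module _ {c ℓ : Level} (R : CommutativeRing c ℓ) where
  open CommutativeRing R renaming (refl to ≈-refl; sym to ≈-sym; trans to ≈-trans)
  open import Relation.Binary.Reasoning.Setoid setoid

  M-diagonal : ∀ α → M R α (toList α) ≈ 1#
  M-diagonal α rewrite ways-diagonal (toList α) = +-identityʳ 1#

  term-vanishes : ∀ b β α → (len β < len α → b ≈ 0#) → β ≢ α → b * M R β (toList α) ≈ 0#
  term-vanishes b β α shorter⇒b≈0 β≢α with ways (toList β) (toList α) ≟ 0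
  ... | yes ways≡0 rewrite ways≡0 = zeroʳ b
  ... | no ways≢0 with ways-toList-triangular β α ways≢0
  ...   | inj₁ β≡α = ⊥-elim (β≢α β≡α)
  ...   | inj₂ lt  = ≈-trans (*-congʳ (shorter⇒b≈0 lt)) (zeroˡ _)

  VanishBelow : ℕ → List (Carrier × LWC) → Set (c ⊔ ℓ)
  VanishBelow n xs = ∀ {a α} → (a , α) ∈ xs → len α < n → a ≈ 0#

  lincomb-toList-∉ : ∀ α xs → VanishBelow (len α) xs → α ∉ map proj₂ xs → lincomb R xs (toList α) ≈ 0#
  lincomb-toList-∉ α []             _      _   = ≈-refl
  lincomb-toList-∉ α ((b , β) ∷ xs) vanish α∉ = begin
    b * M R β (toList α) + lincomb R xs (toList α)
      ≈⟨ +-cong (term-vanishes b β α (vanish (here refl)) (λ { refl → α∉ (here refl) }))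
                (lincomb-toList-∉ α xs (vanish ∘ there) (α∉ ∘ there)) ⟩
    0# + 0#
      ≈⟨ +-identityʳ 0# ⟩
    0# ∎

  lincomb-toList-∈ : ∀ a α xs → Unique (map proj₂ xs) → (a , α) ∈ xs → VanishBelow (len α) xs
                   → lincomb R xs (toList α) ≈ a
  lincomb-toList-∈ a α ((a , α) ∷ xs) (α∉ ∷ _) (here refl) vanish = begin
    a * M R α (toList α) + lincomb R xs (toList α)
      ≈⟨ +-cong (*-congˡ (M-diagonal α)) (lincomb-toList-∉ α xs (vanish ∘ there) (All¬⇒¬Any α∉)) ⟩
    a * 1# + 0#
      ≈⟨ +-identityʳ _ ⟩
    a * 1#
      ≈⟨ *-identityʳ a ⟩
    a ∎
  lincomb-toList-∈ a α ((b , β) ∷ xs) (β∉ ∷ unique) (there m) vanish = begin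
    b * M R β (toList α) + lincomb R xs (toList α)
      ≈⟨ +-cong (term-vanishes b β α (vanish (here refl)) (All.lookup β∉ (∈-map⁺ proj₂ m)))
                (lincomb-toList-∈ a α xs unique m (vanish ∘ there)) ⟩
    0# + a
      ≈⟨ +-identityˡ a ⟩
    a ∎

  lincomb≈0⇒vanishBelow : ∀ xs → Unique (map proj₂ xs) → (∀ e → lincomb R xs e ≈ 0#) → ∀ n → VanishBelow n xs
  lincomb≈0⇒vanishBelow xs unique lincomb≈0 (suc n) {a} {α} m lt with m<1+n⇒m<n∨m≡n lt
  ... | inj₁ lt′ = lincomb≈0⇒vanishBelow xs unique lincomb≈0 n m lt′
  ... | inj₂ refl = begin
    a                        ≈⟨ ≈-sym (lincomb-toList-∈ a α xs unique m (lincomb≈0⇒vanishBelow xs unique lincomb≈0 n)) ⟩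
    lincomb R xs (toList α)  ≈⟨ lincomb≈0 (toList α) ⟩
    0#                       ∎

  linIndep : LinIndep R
  linIndep xs unique lincomb≈0 =
    All.tabulate (λ {(_ , α)} m → lincomb≈0⇒vanishBelow xs unique lincomb≈0 (suc (len α)) m ≤-refl)

  spans : Spans R
  spans = (λ α → ((1# , α) ∷ []) , λ _ → ≈-sym (≈-trans (+-identityʳ _) (*-identityˡ _)))
        , (λ _ inLWCQSym → inLWCQSym)

lemma3p6 : ∀ {c ℓ} (R : CommutativeRing c ℓ) → IsBasisOfLWCQSym R
lemma3p6 R = spans R , linIndep R
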